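{- Let $f$ be a non-negative monotone submodular function and run the MSbM Algorithm (described in the context) with parameters $C>0$ and $q=1$. Let $S$ be the set of edges pushed onto the stack and $M$ the output $b$-matching. Then $f(M)\ge\left(1-\frac1C\right)f(S)$.
   Context: Setting: $G=(V,E)$ is a graph, $b\in\mathbb{Z}_{>0}^V$, and $f:2^E\to\mathbb{R}_{\ge0}$ is given by a value oracle. A $b$-matching is a set of edges in which each vertex $v$ has degree at most $b_v$. Edges arrive in a stream $e^{(1)},\dots,e^{(|E|)}$; write $e<e'$ if $e$ arrives before $e'$. Let $f_S(e)=f(S\cup\{e\})-f(S)$ and $f(e:S)=f_{S\cap\{e'<e\}}(e)$. MSbM Algorithm with parameters $C>0$, $q\in[0,1]$: Initialize an empty stack $S$ and potentials $\phi_v^{(0)}=0$. For $t=1,\dots,|E|$: let $e=e^{(t)}$ and set $\phi^{(t)}_v=\phi^{(t-1)}_v$ for all $v$. If $C\sum_{v\in e}\phi^{(t-1)}_v\ge f(e:S)$, skip $e$. Otherwise, with probability $q$, push $e$ onto $S$ and for each $v\in e$ set $w_{ev}=\big(f(e:S)-\sum_{u\in e}\phi^{(t-1)}_u\big)/b_v$ and $\phi^{(t)}_v=\phi^{(t-1)}_v+w_{ev}$. Post-processing: set $M=\emptyset$; pop the edges of $S$ (last pushed first), adding a popped edge $e$ to $M$ if every $v\in e$ has fewer than $b_v$ edges of $M$ incident to it. Output $M$.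
   Formalization: The set function f takes values in the non-negative rationals rather than the non-negative reals, and the parameter C is a positive rational. -}

module Defs where

open import Data.Nat using (ℕ; NonZero; _<ᵇ_)
open import Data.Integer using (+_)
open import Data.Rational using (ℚ; 0ℚ; _+_; _-_; _*_; _/_; _≤_)
open import Data.Rational.Properties using (_≤?_)
open import Data.Fin using (Fin; toℕ; _≟_)
open import Data.Fin.Subset using (Subset; ⁅_⁆; _∪_; _∩_; _⊆_; _∈_)
import Data.Fin.Subset as Sub
open import Data.Vec using (tabulate)
open import Data.List using (List; []; _∷_; foldr; foldl; filterᵇ; length; allFin)
open import Data.Product using (_×_; _,_; proj₁; proj₂)
open import Data.Bool using (Bool; true; false; if_then_else_; _∨_; _∧_)
open import Relation.Nullary using (yes; no; ¬_)
open import Relation.Nullary.Decidable using (⌊_⌋)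
open import Relation.Binary.PropositionalEquality using (_≡_)

-- An edge e is
-- identified with its arrival position in the stream: e^(1),...,e^(m)
-- are the edges 0,1,...,m-1 of Fin m in increasing order, so e < e'
-- (arrival order) is toℕ e < toℕ e'.  'ends e = (u , w)' are the two
-- endpoints of e.

Ends : ℕ → ℕ → Set
Ends n m = Fin m → Fin n × Fin n

IsGraph : ∀ {n m} → Ends n m → Set
IsGraph {n} {m} ends =
  (∀ e → ¬ (proj₁ (ends e) ≡ proj₂ (ends e))) ×
  (∀ e e' → ((proj₁ (ends e) ≡ proj₁ (ends e') × proj₂ (ends e) ≡ proj₂ (ends e'))
            → e ≡ e') ×
            ((proj₁ (ends e) ≡ proj₂ (ends e') × proj₂ (ends e) ≡ proj₁ (ends e'))
            → e ≡ e'))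

NonNeg : ∀ {m} → (Subset m → ℚ) → Set
NonNeg {m} f = ∀ (A : Subset m) → 0ℚ ≤ f A

Monotone : ∀ {m} → (Subset m → ℚ) → Set
Monotone {m} f = ∀ (A B : Subset m) → A ⊆ B → f A ≤ f B

Submodular : ∀ {m} → (Subset m → ℚ) → Set
Submodular {m} f = ∀ (A B : Subset m) → f (A ∪ B) + f (A ∩ B) ≤ f A + f B

before : ∀ {m} → Fin m → Subset m
before e = tabulate (λ e' → toℕ e' <ᵇ toℕ e)

toSet : ∀ {m} → List (Fin m) → Subset m
toSet = foldr (λ e A → ⁅ e ⁆ ∪ A) Sub.⊥

marginal : ∀ {m} → (Subset m → ℚ) → Subset m → Fin m → ℚ
marginal f S e = f (S ∪ ⁅ e ⁆) - f S

-- f(e : S) = f_{S ∩ {e' < e}}(e)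
margBefore : ∀ {m} → (Subset m → ℚ) → Subset m → Fin m → ℚ
margBefore f S e = marginal f (S ∩ before e) e

-- The MSbM algorithm with q = 1 (deterministic: every non-skipped edge
-- is pushed).

_/ℕ_ : ℚ → (k : ℕ) → .{{NonZero k}} → ℚ
x /ℕ k = x * (+ 1 / k)

-- state: the stack (head = top, i.e. last pushed) and the potentials
State : ℕ → ℕ → Set
State n m = List (Fin m) × (Fin n → ℚ)

module MSbM {n m : ℕ} (ends : Ends n m) (b : Fin n → ℕ)
            (bnz : ∀ v → NonZero (b v))
            (f : Subset m → ℚ) (C : ℚ) where

  step : State n m → Fin m → State n m
  step (S , φ) e with ends e
  ... | (u , w) with margBefore f (toSet S) e ≤? C * (φ u + φ w)
  ...   | yes _ = (S , φ)
  ...   | no  _ = (e ∷ S , φ')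
    where
      δ : ℚ
      δ = margBefore f (toSet S) e - (φ u + φ w)
      wt : Fin n → ℚ
      wt v = (δ /ℕ b v) {{bnz v}}
      φ' : Fin n → ℚ
      φ' x = φ x + (if ⌊ x ≟ u ⌋ then wt u else 0ℚ)
                 + (if ⌊ x ≟ w ⌋ then wt w else 0ℚ)

  initial : State n m
  initial = ([] , λ _ → 0ℚ)

  final : State n m
  final = foldl step initial (allFin m)

  stack : List (Fin m)
  stack = proj₁ final

  degree : List (Fin m) → Fin n → ℕ
  degree M v = length (filterᵇ (λ e → ⌊ proj₁ (ends e) ≟ v ⌋ ∨ ⌊ proj₂ (ends e) ≟ v ⌋) M)

  popAll : List (Fin m) → List (Fin m) → List (Fin m)
  popAll M [] = M
  popAll M (e ∷ S) =
    if (degree M (proj₁ (ends e)) <ᵇ b (proj₁ (ends e)))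
       ∧ (degree M (proj₂ (ends e)) <ᵇ b (proj₂ (ends e)))
    then popAll (e ∷ M) S
    else popAll M S

  output : List (Fin m)
  output = popAll [] stack

-- For C ≤ 1 the factor 1 − 1/C is nonpositive and there is nothing to prove.
-- Let C ≥ 1.  A pushed edge e has surplus δₑ = f(e:S) − Σ_{v∈e} φᵥ, and the
-- push rule C Σ_{v∈e} φᵥ < f(e:S) gives δₑ ≥ (1 − 1/C) f(e:S) ≥ 0; by
-- submodularity f(S) ≤ f(∅) + Σₑ f(e:S), hence (1 − 1/C) f(S) ≤ f(∅) + Σₑ δₑ.
-- Popping the stack preserves
--   f(∅) + Σ (surpluses still on the stack) + G ≤ f(output) + Σ_{e∈M} Σ_{v∈e} φᵥ,
-- where M is the matching built so far, G a gain M adds to every subset of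
-- the remaining stack, and φ the potentials when the top of that stack was
-- pushed.  A kept edge e adds f(e:S) to G and its own Σ_{v∈e} φᵥ to the right;
-- an edge dropped at a saturated endpoint v is paid for by the b_v edges of M
-- at v, each of whose potential sums grew by δₑ / b_v when e was pushed.
module Submission where

open import Defs
open import Data.Nat using (ℕ; NonZero; >-nonZero) renaming (_<_ to _<ℕ_)
open import Data.Rational using (ℚ; 0ℚ; 1ℚ; _-_; _*_; _≤_; _<_; 1/_; Positive; positive)
open import Data.Rational.Properties using (pos⇒nonZero)
open import Data.Fin using (Fin)
open import Data.Fin.Subset using (Subset)

open import Algebra.Bundles using (CommutativeMonoid; CommutativeRing)
open import Data.Bool using (true; false; T; if_then_else_)
open import Data.Bool.Properties using (T-≡)
open import Data.Fin using (_≟_) renaming (_<_ to _<ᶠ_)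
open import Data.Fin.Subset using (⁅_⁆; _∪_; _∩_; _⊆_; _∈_; ⊥)
open import Data.Fin.Subset.Properties
  using (⊆-refl; ∉⊥; x∈⁅y⁆⇒x≡y; p∩q⊆p; x∈p∩q⁺; p⊆p∪q; q⊆p∪q; x∈p∪q⁺; x∈p∪q⁻;
         ∪-comm; ∪-assoc; ∪-identityˡ; ∪-identityʳ)
import Data.Integer as ℤ
import Data.Integer.Properties as ℤP
open import Data.List using (List; []; _∷_; foldl; allFin)
open import Data.List.Relation.Unary.All as All using (All; []; _∷_)
open import Data.List.Relation.Unary.AllPairs using (AllPairs; _∷_)
open import Data.List.Relation.Unary.AllPairs.Properties using (tabulate⁺-<)
open import Data.Nat using (zero; suc; z≤n; s≤s; _<ᵇ_) renaming (_≤_ to _≤ℕ_)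
import Data.Nat.Coprimality as Coprime
import Data.Nat.Properties as ℕP
open import Data.Product using (_,_; proj₁; proj₂)
open import Data.Rational using (mkℚ; _+_; -_; _/_; NonNegative; nonNegative)
open import Data.Rational.Properties using (_≤?_)
import Data.Rational.Properties as ℚP
open import Data.Rational.Solver using (module +-*-Solver)
open import Data.Sum as Sum using (_⊎_; inj₁; inj₂; [_,_])
open import Data.Vec.Properties using (lookup⇒[]=; lookup∘tabulate)
open import Function using (_∘_; id; Equivalence)
open import Relation.Binary.PropositionalEquality
  using (_≡_; refl; sym; trans; cong; subst; module ≡-Reasoning)
open import Relation.Nullary using (yes; no; ¬_; contradiction)
open import Relation.Nullary.Decidable using (⌊_⌋)

open import Algebra.Properties.Semiring.Mult (CommutativeRing.semiring ℚP.+-*-commutativeRing)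
  using (_×_; ×-comm-*; ×-assoc-*)
open import Algebra.Properties.CommutativeSemigroup
  (CommutativeMonoid.commutativeSemigroup ℚP.+-0-commutativeMonoid)
  using (interchange; x∙yz≈xz∙y; x∙yz≈y∙xz; xy∙z≈xz∙y; xy∙z≈x∙zy)

fromℕ : ℕ → ℚ
fromℕ k = mkℚ (ℤ.+ k) 0 (Coprime.sym (Coprime.1-coprimeTo k))

×-1ℚ : ∀ k → k × 1ℚ ≡ fromℕ k
×-1ℚ zero    = refl
×-1ℚ (suc k) = begin
  1ℚ + k × 1ℚ     ≡⟨ cong (_+_ 1ℚ) (×-1ℚ k) ⟩
  1ℚ + fromℕ k    ≡⟨ ℚP./-cong (cong (ℤ._+_ (ℤ.+ 1)) (ℤP.*-identityʳ (ℤ.+ k))) refl ⟩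
  ℤ.+ suc k / 1   ≡⟨ ℚP.normalize-coprime _ ⟩
  fromℕ (suc k)   ∎
  where open ≡-Reasoning

×-/ℕ-inverse : ∀ k .{{_ : NonZero k}} x → k × (x /ℕ k) ≡ x
×-/ℕ-inverse k@(suc _) x = begin
  k × (x * r)                ≡⟨ ×-comm-* k x r ⟨
  x * (k × r)                ≡⟨ cong (λ z → x * (k × z)) (ℚP.*-identityˡ r) ⟨
  x * (k × (1ℚ * r))         ≡⟨ cong (x *_) (×-assoc-* k 1ℚ r) ⟨
  x * ((k × 1ℚ) * r)         ≡⟨ cong (λ z → x * (z * r)) (×-1ℚ k) ⟩
  x * (fromℕ k * r)          ≡⟨ cong (λ z → x * (fromℕ k * z)) (ℚP.normalize-coprime (Coprime.1-coprimeTo k)) ⟩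
  x * (fromℕ k * 1/ fromℕ k) ≡⟨ cong (x *_) (ℚP.*-inverseʳ (fromℕ k)) ⟩
  x * 1ℚ                     ≡⟨ ℚP.*-identityʳ x ⟩
  x                          ∎
  where open ≡-Reasoning
        r = ℤ.+ 1 / k

×-nonNeg : ∀ k {c} → 0ℚ ≤ c → 0ℚ ≤ k × c
×-nonNeg zero    c≥0 = ℚP.≤-refl
×-nonNeg (suc k) c≥0 = ℚP.+-mono-≤ c≥0 (×-nonNeg k c≥0)

×-monoˡ-≤ : ∀ {c j k} → 0ℚ ≤ c → j ≤ℕ k → j × c ≤ k × c
×-monoˡ-≤ {k = k} c≥0 z≤n       = ×-nonNeg k c≥0
×-monoˡ-≤ {c}     c≥0 (s≤s j≤k) = ℚP.+-monoʳ-≤ c (×-monoˡ-≤ c≥0 j≤k)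

/ℕ-nonNeg : ∀ k .{{_ : NonZero k}} {x} → 0ℚ ≤ x → 0ℚ ≤ x /ℕ k
/ℕ-nonNeg k {x} x≥0 = begin
  0ℚ            ≡⟨ ℚP.*-zeroˡ r ⟨
  0ℚ * r        ≤⟨ ℚP.*-monoʳ-≤-nonNeg r {{ℚP.normalize-nonNeg 1 k}} x≥0 ⟩
  x * r         ∎
  where open ℚP.≤-Reasoning
        r = ℤ.+ 1 / k

≤-exchange : ∀ a b c d → a + d ≤ c + b → a - b ≤ c - d
≤-exchange a b c d a+d≤c+b = begin
  a - b                 ≡⟨ solve 4 (λ a b c d → a :- b := (a :+ d) :+ (:- b :- d)) refl a b c d ⟩
  (a + d) + (- b - d)   ≤⟨ ℚP.+-monoˡ-≤ (- b - d) a+d≤c+b ⟩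
  (c + b) + (- b - d)   ≡⟨ solve 4 (λ a b c d → (c :+ b) :+ (:- b :- d) := c :- d) refl a b c d ⟩
  c - d                 ∎
  where open ℚP.≤-Reasoning
        open +-*-Solver

1/-nonNeg : ∀ p .{{_ : Positive p}} → NonNegative ((1/ p) {{pos⇒nonZero p}})
1/-nonNeg p = ℚP.pos⇒nonNeg ((1/ p) {{pos⇒nonZero p}}) {{ℚP.1/pos⇒pos p}}

1/-≤-1 : ∀ p .{{_ : Positive p}} → 1ℚ ≤ p → (1/ p) {{pos⇒nonZero p}} ≤ 1ℚ
1/-≤-1 p 1≤p = begin
  p⁻¹            ≡⟨ ℚP.*-identityʳ p⁻¹ ⟨
  p⁻¹ * 1ℚ       ≤⟨ ℚP.*-monoˡ-≤-nonNeg p⁻¹ {{1/-nonNeg p}} 1≤p ⟩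
  p⁻¹ * p        ≡⟨ ℚP.*-inverseˡ p {{pos⇒nonZero p}} ⟩
  1ℚ             ∎
  where open ℚP.≤-Reasoning
        p⁻¹ = (1/ p) {{pos⇒nonZero p}}

1≤1/ : ∀ p .{{_ : Positive p}} → p ≤ 1ℚ → 1ℚ ≤ (1/ p) {{pos⇒nonZero p}}
1≤1/ p p≤1 = begin
  1ℚ             ≡⟨ ℚP.*-inverseʳ p {{pos⇒nonZero p}} ⟨
  p * p⁻¹        ≤⟨ ℚP.*-monoʳ-≤-nonNeg p⁻¹ {{1/-nonNeg p}} p≤1 ⟩
  1ℚ * p⁻¹       ≡⟨ ℚP.*-identityˡ p⁻¹ ⟩
  p⁻¹            ∎
  where open ℚP.≤-Reasoning
        p⁻¹ = (1/ p) {{pos⇒nonZero p}}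

1-1/-nonNeg : ∀ p .{{_ : Positive p}} → 1ℚ ≤ p → 0ℚ ≤ 1ℚ - (1/ p) {{pos⇒nonZero p}}
1-1/-nonNeg p 1≤p = begin
  0ℚ                              ≡⟨ ℚP.+-inverseʳ 1ℚ ⟨
  1ℚ - 1ℚ                         ≤⟨ ℚP.+-monoʳ-≤ 1ℚ (ℚP.neg-antimono-≤ (1/-≤-1 p 1≤p)) ⟩
  1ℚ - (1/ p) {{pos⇒nonZero p}}   ∎
  where open ℚP.≤-Reasoning

1-1/-≤-1 : ∀ p .{{_ : Positive p}} → 1ℚ - (1/ p) {{pos⇒nonZero p}} ≤ 1ℚ
1-1/-≤-1 p = begin
  1ℚ - (1/ p) {{pos⇒nonZero p}}   ≤⟨ ℚP.+-monoʳ-≤ 1ℚ (ℚP.neg-antimono-≤ (ℚP.nonNegative⁻¹ ((1/ p) {{pos⇒nonZero p}}) {{1/-nonNeg p}})) ⟩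
  1ℚ + 0ℚ                         ≡⟨ ℚP.+-identityʳ 1ℚ ⟩
  1ℚ                              ∎
  where open ℚP.≤-Reasoning

1-1/-nonPos : ∀ p .{{_ : Positive p}} → p ≤ 1ℚ → 1ℚ - (1/ p) {{pos⇒nonZero p}} ≤ 0ℚ
1-1/-nonPos p p≤1 = begin
  1ℚ - (1/ p) {{pos⇒nonZero p}}   ≤⟨ ℚP.+-monoʳ-≤ 1ℚ (ℚP.neg-antimono-≤ (1≤1/ p p≤1)) ⟩
  1ℚ - 1ℚ                         ≡⟨ ℚP.+-inverseʳ 1ℚ ⟩
  0ℚ                              ∎
  where open ℚP.≤-Reasoning

nonPos-*-≤ : ∀ {a x y} → a ≤ 0ℚ → 0ℚ ≤ x → 0ℚ ≤ y → a * x ≤ y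
nonPos-*-≤ {a} {x} {y} a≤0 x≥0 y≥0 = begin
  a * x      ≤⟨ ℚP.*-monoʳ-≤-nonNeg x {{nonNegative x≥0}} a≤0 ⟩
  0ℚ * x     ≡⟨ ℚP.*-zeroˡ x ⟩
  0ℚ         ≤⟨ y≥0 ⟩
  y          ∎
  where open ℚP.≤-Reasoning

module _ {m : ℕ} {f : Subset m → ℚ} where

  +-marginal : ∀ S e → f S + marginal f S e ≡ f (S ∪ ⁅ e ⁆)
  +-marginal S e = solve 2 (λ x y → x :+ (y :- x) := y) refl (f S) (f (S ∪ ⁅ e ⁆))
    where open +-*-Solver

  marginal-nonNeg : Monotone f → ∀ S e → 0ℚ ≤ marginal f S e
  marginal-nonNeg mono S e = begin
    0ℚ                       ≡⟨ ℚP.+-inverseʳ (f S) ⟨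
    f S - f S                ≤⟨ ℚP.+-monoˡ-≤ (- f S) (mono S (S ∪ ⁅ e ⁆) (p⊆p∪q ⁅ e ⁆)) ⟩
    f (S ∪ ⁅ e ⁆) - f S      ∎
    where open ℚP.≤-Reasoning

  marginal-antitone : Monotone f → Submodular f → ∀ {P Q} e → P ⊆ Q → marginal f Q e ≤ marginal f P e
  marginal-antitone mono subm {P} {Q} e P⊆Q =
    ≤-exchange (f (Q ∪ ⁅ e ⁆)) (f Q) (f (P ∪ ⁅ e ⁆)) (f P) (begin
    f (Q ∪ ⁅ e ⁆) + f P                         ≤⟨ ℚP.+-mono-≤ (mono _ _ Q∪e⊆) (mono _ _ P⊆) ⟩
    f ((P ∪ ⁅ e ⁆) ∪ Q) + f ((P ∪ ⁅ e ⁆) ∩ Q)   ≤⟨ subm (P ∪ ⁅ e ⁆) Q ⟩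
    f (P ∪ ⁅ e ⁆) + f Q                         ∎)
    where
      open ℚP.≤-Reasoning
      Q∪e⊆ : Q ∪ ⁅ e ⁆ ⊆ (P ∪ ⁅ e ⁆) ∪ Q
      Q∪e⊆ = x∈p∪q⁺ ∘ [ inj₂ , inj₁ ∘ q⊆p∪q P ⁅ e ⁆ ] ∘ x∈p∪q⁻ Q ⁅ e ⁆
      P⊆ : P ⊆ (P ∪ ⁅ e ⁆) ∩ Q
      P⊆ x∈P = x∈p∩q⁺ (p⊆p∪q ⁅ e ⁆ x∈P , P⊆Q x∈P)

All-∈-toSet : ∀ {m} {P : Fin m → Set} {xs x} → All P xs → x ∈ toSet xs → P x
All-∈-toSet {xs = []}     []         x∈⊥ = contradiction x∈⊥ ∉⊥
All-∈-toSet {xs = y ∷ xs} (py ∷ pxs) x∈ with x∈p∪q⁻ ⁅ y ⁆ (toSet xs) x∈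
... | inj₁ x∈⁅y⁆ rewrite x∈⁅y⁆⇒x≡y y x∈⁅y⁆ = py
... | inj₂ x∈xs = All-∈-toSet pxs x∈xs

toSet⊆before : ∀ {m} {S : List (Fin m)} {e} → All (_<ᶠ e) S → toSet S ⊆ before e
toSet⊆before {e = e} S<e {x} x∈S =
  lookup⇒[]= x (before e) (trans (lookup∘tabulate _ x) (Equivalence.to T-≡ (ℕP.<⇒<ᵇ (All-∈-toSet S<e x∈S))))

<ᵇ≡false⇒≥ : ∀ {i j} → (i <ᵇ j) ≡ false → j ≤ℕ i
<ᵇ≡false⇒≥ i≮j = ℕP.≮⇒≥ (λ i<j → subst T i≮j (ℕP.<⇒<ᵇ i<j))

module Analysis {n m : ℕ} (ends : Ends n m) (b : Fin n → ℕ) (bpos : ∀ v → 0 <ℕ b v)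
                (f : Subset m → ℚ) (C : ℚ) where

  bnz : ∀ v → NonZero (b v)
  bnz v = >-nonZero (bpos v)

  open MSbM ends b bnz f C

  Incident : Fin n → Fin m → Set
  Incident v e = v ≡ proj₁ (ends e) ⊎ v ≡ proj₂ (ends e)

  gain : List (Fin m) → Fin m → ℚ
  gain S e = margBefore f (toSet S) e

  cover : (Fin n → ℚ) → Fin m → ℚ
  cover φ e = φ (proj₁ (ends e)) + φ (proj₂ (ends e))

  coverSum : (Fin n → ℚ) → List (Fin m) → ℚ
  coverSum φ []      = 0ℚ
  coverSum φ (e ∷ M) = cover φ e + coverSum φ M

  surplus : List (Fin m) → (Fin n → ℚ) → Fin m → ℚ
  surplus S φ e = gain S e - cover φ e

  share : ℚ → Fin n → ℚ
  share δ v = (δ /ℕ b v) {{bnz v}}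

  bump : ℚ → Fin n → Fin n → ℚ
  bump δ v x = if ⌊ x ≟ v ⌋ then share δ v else 0ℚ

  -- Definitionally the potential update of MSbM.step.
  raise : (Fin n → ℚ) → ℚ → Fin m → Fin n → ℚ
  raise φ δ e x = φ x + bump δ (proj₁ (ends e)) x + bump δ (proj₂ (ends e)) x

  data Trace : State n m → Set where
    []   : Trace initial
    push : ∀ {S φ} e → Trace (S , φ) → All (_<ᶠ e) S → ¬ (gain S e ≤ C * cover φ e) →
           Trace (e ∷ S , raise φ (surplus S φ e) e)

  data StepView (S : List (Fin m)) (φ : Fin n → ℚ) (e : Fin m) : State n m → Set where
    skipped : StepView S φ e (S , φ)
    pushed  : ¬ (gain S e ≤ C * cover φ e) → StepView S φ e (e ∷ S , raise φ (surplus S φ e) e)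

  step-view : ∀ S φ e → StepView S φ e (step (S , φ) e)
  step-view S φ e with gain S e ≤? C * cover φ e
  ... | yes _      = skipped
  ... | no  g≰Ccov = pushed g≰Ccov

  foldl-trace : ∀ {S φ} es → Trace (S , φ) → AllPairs _<ᶠ_ es → All (λ e → All (_<ᶠ e) S) es →
                Trace (foldl step (S , φ) es)
  foldl-trace []       t _ _ = t
  foldl-trace {S} {φ} (e ∷ es) t (e<es ∷ es↑) (S<e ∷ S<es) with step (S , φ) e | step-view S φ e
  ... | _ | skipped       = foldl-trace es t es↑ S<es
  ... | _ | pushed g≰Ccov =
    foldl-trace es (push e t S<e g≰Ccov) es↑ (All.zipWith (λ (e<x , S<x) → e<x ∷ S<x) (e<es , S<es))

  trace-final : Trace final
  trace-final = foldl-trace (allFin m) [] (tabulate⁺-< id) (All.universal (λ _ → []) (allFin m))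

  data PopView (M : List (Fin m)) (e : Fin m) (S : List (Fin m)) : List (Fin m) → Set where
    kept      : PopView M e S (popAll (e ∷ M) S)
    saturated : ∀ v → Incident v e → b v ≤ℕ degree M v → PopView M e S (popAll M S)

  pop-view : ∀ M e S → PopView M e S (popAll M (e ∷ S))
  pop-view M e S
    with degree M (proj₁ (ends e)) <ᵇ b (proj₁ (ends e)) in room₁
       | degree M (proj₂ (ends e)) <ᵇ b (proj₂ (ends e)) in room₂
  ... | true  | true  = kept
  ... | false | _     = saturated _ (inj₁ refl) (<ᵇ≡false⇒≥ room₁)
  ... | true  | false = saturated _ (inj₂ refl) (<ᵇ≡false⇒≥ room₂)

  _≤ᵖ_ : (Fin n → ℚ) → (Fin n → ℚ) → Set
  φ ≤ᵖ ψ = ∀ x → φ x ≤ ψ x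

  cover-mono : ∀ {φ ψ} → φ ≤ᵖ ψ → ∀ e → cover φ e ≤ cover ψ e
  cover-mono φ≤ψ e = ℚP.+-mono-≤ (φ≤ψ _) (φ≤ψ _)

  coverSum-mono : ∀ {φ ψ} → φ ≤ᵖ ψ → ∀ M → coverSum φ M ≤ coverSum ψ M
  coverSum-mono φ≤ψ []      = ℚP.≤-refl
  coverSum-mono φ≤ψ (e ∷ M) = ℚP.+-mono-≤ (cover-mono φ≤ψ e) (coverSum-mono φ≤ψ M)

  coverSum-zero : ∀ M → coverSum (λ _ → 0ℚ) M ≡ 0ℚ
  coverSum-zero []      = refl
  coverSum-zero (e ∷ M) = cong (0ℚ + 0ℚ +_) (coverSum-zero M)

  cover-bump : ∀ {φ ψ v c} → φ ≤ᵖ ψ → φ v + c ≤ ψ v → ∀ {e} → Incident v e →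
               cover φ e + c ≤ cover ψ e
  cover-bump {φ} {ψ} {c = c} φ≤ψ bumped {e} (inj₁ refl) = begin
    φ u + φ w + c         ≡⟨ xy∙z≈xz∙y (φ u) (φ w) c ⟩
    φ u + c + φ w         ≤⟨ ℚP.+-mono-≤ bumped (φ≤ψ w) ⟩
    cover ψ e             ∎
    where open ℚP.≤-Reasoning
          u = proj₁ (ends e)
          w = proj₂ (ends e)
  cover-bump {φ} {ψ} {c = c} φ≤ψ bumped {e} (inj₂ refl) = begin
    φ u + φ w + c         ≡⟨ ℚP.+-assoc (φ u) (φ w) c ⟩
    φ u + (φ w + c)       ≤⟨ ℚP.+-mono-≤ (φ≤ψ u) bumped ⟩
    cover ψ e             ∎
    where open ℚP.≤-Reasoning
          u = proj₁ (ends e)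
          w = proj₂ (ends e)

  data DegreeView (v : Fin n) (y : Fin m) (M : List (Fin m)) : ℕ → Set where
    incident : Incident v y → DegreeView v y M (suc (degree M v))
    apart    : DegreeView v y M (degree M v)

  degree-view : ∀ v y M → DegreeView v y M (degree (y ∷ M) v)
  degree-view v y M with proj₁ (ends y) ≟ v | proj₂ (ends y) ≟ v
  ... | yes u≡v | _       = incident (inj₁ (sym u≡v))
  ... | no _    | yes w≡v = incident (inj₂ (sym w≡v))
  ... | no _    | no _    = apart

  coverSum-bump : ∀ {φ ψ v c} → φ ≤ᵖ ψ → φ v + c ≤ ψ v → ∀ M →
                  coverSum φ M + degree M v × c ≤ coverSum ψ M
  coverSum-bump φ≤ψ bumped [] = ℚP.≤-reflexive (ℚP.+-identityʳ 0ℚ)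
  coverSum-bump {φ} {ψ} {v} {c} φ≤ψ bumped (y ∷ M) with degree (y ∷ M) v | degree-view v y M
  ... | _ | incident v∈y = begin
    cover φ y + coverSum φ M + (c + degree M v × c)   ≡⟨ interchange (cover φ y) (coverSum φ M) c (degree M v × c) ⟩
    cover φ y + c + (coverSum φ M + degree M v × c)   ≤⟨ ℚP.+-mono-≤ (cover-bump φ≤ψ bumped v∈y) (coverSum-bump φ≤ψ bumped M) ⟩
    cover ψ y + coverSum ψ M                          ∎
    where open ℚP.≤-Reasoning
  ... | _ | apart = begin
    cover φ y + coverSum φ M + degree M v × c         ≡⟨ ℚP.+-assoc (cover φ y) (coverSum φ M) (degree M v × c) ⟩
    cover φ y + (coverSum φ M + degree M v × c)       ≤⟨ ℚP.+-mono-≤ (cover-mono φ≤ψ y) (coverSum-bump φ≤ψ bumped M) ⟩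
    cover ψ y + coverSum ψ M                          ∎
    where open ℚP.≤-Reasoning

  share-nonNeg : ∀ {δ} → 0ℚ ≤ δ → ∀ v → 0ℚ ≤ share δ v
  share-nonNeg δ≥0 v = /ℕ-nonNeg (b v) {{bnz v}} δ≥0

  bump-nonNeg : ∀ {δ} → 0ℚ ≤ δ → ∀ v x → 0ℚ ≤ bump δ v x
  bump-nonNeg δ≥0 v x with ⌊ x ≟ v ⌋
  ... | true  = share-nonNeg δ≥0 v
  ... | false = ℚP.≤-refl

  bump-self : ∀ δ v → bump δ v v ≡ share δ v
  bump-self δ v with v ≟ v
  ... | yes _   = refl
  ... | no v≢v = contradiction refl v≢v

  raise-≥ : ∀ {φ δ} e → 0ℚ ≤ δ → φ ≤ᵖ raise φ δ e
  raise-≥ {φ} {δ} e δ≥0 x = begin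
    φ x                 ≡⟨ trans (ℚP.+-identityʳ _) (ℚP.+-identityʳ (φ x)) ⟨
    φ x + 0ℚ + 0ℚ       ≤⟨ ℚP.+-mono-≤ (ℚP.+-monoʳ-≤ (φ x) (bump-nonNeg δ≥0 _ x)) (bump-nonNeg δ≥0 _ x) ⟩
    raise φ δ e x       ∎
    where open ℚP.≤-Reasoning

  raise-incident : ∀ {φ δ v e} → 0ℚ ≤ δ → Incident v e → φ v + share δ v ≤ raise φ δ e v
  raise-incident {φ} {δ} {e = e} δ≥0 (inj₁ refl) = begin
    φ u + share δ u                ≡⟨ ℚP.+-identityʳ _ ⟨
    φ u + share δ u + 0ℚ           ≡⟨ cong (λ z → φ u + z + 0ℚ) (bump-self δ u) ⟨
    φ u + bump δ u u + 0ℚ          ≤⟨ ℚP.+-monoʳ-≤ (φ u + bump δ u u) (bump-nonNeg δ≥0 w u) ⟩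
    raise φ δ e u                  ∎
    where open ℚP.≤-Reasoning
          u = proj₁ (ends e)
          w = proj₂ (ends e)
  raise-incident {φ} {δ} {e = e} δ≥0 (inj₂ refl) = begin
    φ w + share δ w                ≡⟨ cong (_+ share δ w) (ℚP.+-identityʳ (φ w)) ⟨
    φ w + 0ℚ + share δ w           ≤⟨ ℚP.+-mono-≤ (ℚP.+-monoʳ-≤ (φ w) (bump-nonNeg δ≥0 u w))
                                                  (ℚP.≤-reflexive (sym (bump-self δ w))) ⟩
    raise φ δ e w                  ∎
    where open ℚP.≤-Reasoning
          u = proj₁ (ends e)
          w = proj₂ (ends e)

  surplus-absorbed : ∀ {φ δ v e} M → 0ℚ ≤ δ → Incident v e → b v ≤ℕ degree M v →
                     δ + coverSum φ M ≤ coverSum (raise φ δ e) M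
  surplus-absorbed {φ} {δ} {v} {e} M δ≥0 v∈e full = begin
    δ + coverSum φ M                        ≡⟨ cong (_+ coverSum φ M) (×-/ℕ-inverse (b v) {{bnz v}} δ) ⟨
    b v × share δ v + coverSum φ M          ≤⟨ ℚP.+-monoˡ-≤ (coverSum φ M) (×-monoˡ-≤ (share-nonNeg δ≥0 v) full) ⟩
    degree M v × share δ v + coverSum φ M   ≡⟨ ℚP.+-comm _ (coverSum φ M) ⟩
    coverSum φ M + degree M v × share δ v   ≤⟨ coverSum-bump (raise-≥ e δ≥0) (raise-incident {φ} δ≥0 v∈e) M ⟩
    coverSum (raise φ δ e) M                ∎
    where open ℚP.≤-Reasoning

  gains : ∀ {s} → Trace s → ℚ
  gains []                 = 0ℚ
  gains (push {S} e t _ _) = gain S e + gains t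

  surpluses : ∀ {s} → Trace s → ℚ
  surpluses []                     = 0ℚ
  surpluses (push {S} {φ} e t _ _) = surplus S φ e + surpluses t

  AddsGain : List (Fin m) → ℚ → List (Fin m) → Set
  AddsGain M G S = ∀ P → P ⊆ toSet S → f P + G ≤ f (P ∪ toSet M)

  module _ (nonNeg : NonNeg f) (mono : Monotone f) (subm : Submodular f) where

    gain≤marginal : ∀ {S P e} → All (_<ᶠ e) S → P ⊆ toSet S → gain S e ≤ marginal f P e
    gain≤marginal {e = e} S<e P⊆S =
      marginal-antitone mono subm e (λ x∈P → x∈p∩q⁺ (P⊆S x∈P , toSet⊆before S<e (P⊆S x∈P)))

    stack-bound : ∀ {S φ} (t : Trace (S , φ)) → f (toSet S) ≤ f ⊥ + gains t
    stack-bound []                 = ℚP.≤-reflexive (sym (ℚP.+-identityʳ (f ⊥)))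
    stack-bound (push {S} e t _ _) = begin
      f (⁅ e ⁆ ∪ toSet S)                    ≡⟨ cong f (∪-comm ⁅ e ⁆ (toSet S)) ⟩
      f (toSet S ∪ ⁅ e ⁆)                    ≡⟨ +-marginal {f = f} (toSet S) e ⟨
      f (toSet S) + marginal f (toSet S) e   ≤⟨ ℚP.+-mono-≤ (stack-bound t)
                                                   (marginal-antitone mono subm e (p∩q⊆p (toSet S) (before e))) ⟩
      f ⊥ + gains t + gain S e               ≡⟨ xy∙z≈x∙zy (f ⊥) (gains t) (gain S e) ⟩
      f ⊥ + (gain S e + gains t)             ∎
      where open ℚP.≤-Reasoning

    addsGain-∷ : ∀ {M G S e} → All (_<ᶠ e) S → AddsGain M G (e ∷ S) → AddsGain (e ∷ M) (G + gain S e) S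
    addsGain-∷ {M} {G} {S} {e} S<e M-adds P P⊆S = begin
      f P + (G + g)                ≡⟨ x∙yz≈xz∙y (f P) G g ⟩
      f P + g + G                  ≤⟨ ℚP.+-monoˡ-≤ G (ℚP.+-monoʳ-≤ (f P) (gain≤marginal S<e P⊆S)) ⟩
      f P + marginal f P e + G     ≡⟨ cong (_+ G) (+-marginal {f = f} P e) ⟩
      f (P ∪ ⁅ e ⁆) + G            ≤⟨ M-adds (P ∪ ⁅ e ⁆) (x∈p∪q⁺ ∘ Sum.swap ∘ Sum.map₁ P⊆S ∘ x∈p∪q⁻ P ⁅ e ⁆) ⟩
      f ((P ∪ ⁅ e ⁆) ∪ toSet M)    ≡⟨ cong f (∪-assoc P ⁅ e ⁆ (toSet M)) ⟩
      f (P ∪ (⁅ e ⁆ ∪ toSet M))    ∎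
      where open ℚP.≤-Reasoning
            g = gain S e

    module _ (1≤C : 1ℚ ≤ C) where

      instance
        C-positive : Positive C
        C-positive = positive (ℚP.<-≤-trans (ℚP.positive⁻¹ 1ℚ) 1≤C)

      C⁻¹ : ℚ
      C⁻¹ = (1/ C) {{pos⇒nonZero C}}

      κ : ℚ
      κ = 1ℚ - C⁻¹

      instance
        κ-nonNegative : NonNegative κ
        κ-nonNegative = nonNegative (1-1/-nonNeg C 1≤C)

      κ-gain≤surplus : ∀ {g s} → ¬ (g ≤ C * s) → κ * g ≤ g - s
      κ-gain≤surplus {g} {s} g≰Cs = begin
        κ * g           ≡⟨ solve 2 (λ g i → (con 1ℚ :- i) :* g := g :- g :* i) refl g C⁻¹ ⟩
        g - g * C⁻¹     ≤⟨ ℚP.+-monoʳ-≤ g (ℚP.neg-antimono-≤ s≤g/C) ⟩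
        g - s           ∎
        where
          open ℚP.≤-Reasoning
          open +-*-Solver
          s≤g/C : s ≤ g * C⁻¹
          s≤g/C = begin
            s                ≡⟨ ℚP.*-identityʳ s ⟨
            s * 1ℚ           ≡⟨ cong (s *_) (ℚP.*-inverseʳ C {{pos⇒nonZero C}}) ⟨
            s * (C * C⁻¹)    ≡⟨ solve 3 (λ s c i → s :* (c :* i) := (c :* s) :* i) refl s C C⁻¹ ⟩
            C * s * C⁻¹      ≤⟨ ℚP.*-monoʳ-≤-nonNeg C⁻¹ {{1/-nonNeg C}} (ℚP.<⇒≤ (ℚP.≰⇒> g≰Cs)) ⟩
            g * C⁻¹          ∎

      surplus-nonNeg : ∀ {g s} → 0ℚ ≤ g → ¬ (g ≤ C * s) → 0ℚ ≤ g - s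
      surplus-nonNeg {g} g≥0 g≰Cs = ℚP.≤-trans κg≥0 (κ-gain≤surplus g≰Cs)
        where κg≥0 = ℚP.nonNegative⁻¹ (κ * g) {{ℚP.nonNeg*nonNeg⇒nonNeg κ g {{nonNegative g≥0}}}}

      κ-gains≤surpluses : ∀ {s} (t : Trace s) → κ * gains t ≤ surpluses t
      κ-gains≤surpluses []                     = ℚP.≤-reflexive (ℚP.*-zeroʳ κ)
      κ-gains≤surpluses (push {S} e t _ g≰Ccov) = begin
        κ * (gain S e + gains t)         ≡⟨ ℚP.*-distribˡ-+ κ (gain S e) (gains t) ⟩
        κ * gain S e + κ * gains t       ≤⟨ ℚP.+-mono-≤ (κ-gain≤surplus g≰Ccov) (κ-gains≤surpluses t) ⟩
        _                                ∎
        where open ℚP.≤-Reasoning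

      pop-bound : ∀ {S φ} (t : Trace (S , φ)) M G → AddsGain M G S →
                  f ⊥ + surpluses t + G ≤ f (toSet (popAll M S)) + coverSum φ M
      pop-bound [] M G M-adds = begin
        f ⊥ + 0ℚ + G                          ≡⟨ cong (_+ G) (ℚP.+-identityʳ (f ⊥)) ⟩
        f ⊥ + G                               ≤⟨ M-adds ⊥ ⊆-refl ⟩
        f (⊥ ∪ toSet M)                       ≡⟨ cong f (∪-identityˡ (toSet M)) ⟩
        f (toSet M)                           ≡⟨ ℚP.+-identityʳ (f (toSet M)) ⟨
        f (toSet M) + 0ℚ                      ≡⟨ cong (f (toSet M) +_) (coverSum-zero M) ⟨
        f (toSet M) + coverSum (λ _ → 0ℚ) M   ∎
        where open ℚP.≤-Reasoning
      pop-bound (push {S} {φ} e t S<e g≰Ccov) M G M-adds with popAll M (e ∷ S) | pop-view M e S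
      ... | _ | kept = begin
        f ⊥ + (g - s + Σ) + G                  ≡⟨ solve 5 (λ F g s Σ G → F :+ (g :- s :+ Σ) :+ G := F :+ Σ :+ (G :+ g) :- s)
                                                          refl (f ⊥) g s Σ G ⟩
        f ⊥ + Σ + (G + g) - s                  ≤⟨ ℚP.+-monoˡ-≤ (- s) (pop-bound t (e ∷ M) (G + g) (addsGain-∷ {M} S<e M-adds)) ⟩
        f out + (s + coverSum φ M) - s         ≡⟨ solve 3 (λ o s c → o :+ (s :+ c) :- s := o :+ c) refl (f out) s (coverSum φ M) ⟩
        f out + coverSum φ M                   ≤⟨ ℚP.+-monoʳ-≤ (f out) (coverSum-mono (raise-≥ e δ≥0) M) ⟩
        f out + coverSum (raise φ (g - s) e) M ∎
        where
          open ℚP.≤-Reasoning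
          open +-*-Solver
          g = gain S e
          s = cover φ e
          Σ = surpluses t
          out = toSet (popAll (e ∷ M) S)
          δ≥0 = surplus-nonNeg (marginal-nonNeg mono _ e) g≰Ccov
      ... | _ | saturated v v∈e full = begin
        f ⊥ + (δ + Σ) + G                      ≡⟨ solve 4 (λ F δ Σ G → F :+ (δ :+ Σ) :+ G := δ :+ (F :+ Σ :+ G)) refl (f ⊥) δ Σ G ⟩
        δ + (f ⊥ + Σ + G)                      ≤⟨ ℚP.+-monoʳ-≤ δ (pop-bound t M G (λ P P⊆S → M-adds P (q⊆p∪q ⁅ e ⁆ (toSet S) ∘ P⊆S))) ⟩
        δ + (f out + coverSum φ M)             ≡⟨ x∙yz≈y∙xz δ (f out) (coverSum φ M) ⟩
        f out + (δ + coverSum φ M)             ≤⟨ ℚP.+-monoʳ-≤ (f out) (surplus-absorbed M δ≥0 v∈e full) ⟩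
        f out + coverSum (raise φ δ e) M       ∎
        where
          open ℚP.≤-Reasoning
          open +-*-Solver
          δ = surplus S φ e
          Σ = surpluses t
          out = toSet (popAll M S)
          δ≥0 = surplus-nonNeg (marginal-nonNeg mono _ e) g≰Ccov

      output-bound : κ * f (toSet stack) ≤ f (toSet output)
      output-bound = begin
        κ * f (toSet stack)             ≤⟨ ℚP.*-monoˡ-≤-nonNeg κ (stack-bound t) ⟩
        κ * (f ⊥ + gains t)             ≡⟨ ℚP.*-distribˡ-+ κ (f ⊥) (gains t) ⟩
        κ * f ⊥ + κ * gains t           ≤⟨ ℚP.+-mono-≤ κf⊥≤f⊥ (κ-gains≤surpluses t) ⟩
        f ⊥ + surpluses t               ≡⟨ ℚP.+-identityʳ _ ⟨
        f ⊥ + surpluses t + 0ℚ          ≤⟨ pop-bound t [] 0ℚ (λ P _ → ℚP.≤-reflexive (nothing-gained P)) ⟩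
        f (toSet output) + 0ℚ           ≡⟨ ℚP.+-identityʳ _ ⟩
        f (toSet output)                ∎
        where
          open ℚP.≤-Reasoning
          t = trace-final
          κf⊥≤f⊥ : κ * f ⊥ ≤ f ⊥
          κf⊥≤f⊥ = ℚP.≤-trans (ℚP.*-monoʳ-≤-nonNeg (f ⊥) {{nonNegative (nonNeg ⊥)}} (1-1/-≤-1 C))
                              (ℚP.≤-reflexive (ℚP.*-identityˡ (f ⊥)))
          nothing-gained : ∀ P → f P + 0ℚ ≡ f (P ∪ ⊥)
          nothing-gained P = trans (ℚP.+-identityʳ (f P)) (cong f (sym (∪-identityʳ P)))

lemma4p4 : ∀ {n m : ℕ} (ends : Ends n m) → IsGraph ends →
    (b : Fin n → ℕ) (bpos : ∀ v → 0 <ℕ b v) →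
    (f : Subset m → ℚ) → NonNeg f → Monotone f → Submodular f →
    (C : ℚ) (Cpos : 0ℚ < C) →
    let open MSbM ends b (λ v → >-nonZero (bpos v)) f C in
    (1ℚ - (1/ C) {{pos⇒nonZero C {{positive Cpos}}}}) * f (toSet stack) ≤ f (toSet output)
lemma4p4 ends _ b bpos f nonNeg mono subm C Cpos with ℚP.≤-total 1ℚ C
... | inj₁ 1≤C = Analysis.output-bound ends b bpos f C nonNeg mono subm 1≤C
... | inj₂ C≤1 = nonPos-*-≤ (1-1/-nonPos C {{positive Cpos}} C≤1) (nonNeg _) (nonNeg _)
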